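{- Let $G$ be a finite simple undirected graph on $n$ vertices with adjacency matrix $A$, and let $\overline{A}=J-I-A$ be the adjacency matrix of its complement $\overline{G}$ (same vertex ordering). Let $e$ be the all-ones vector of length $n$, $W=[e,Ae,\ldots,A^{n-1}e]$ and $\overline{W}=[e,\overline{A}e,\ldots,\overline{A}^{n-1}e]$. For $k=1,\ldots,n$ let $W_k$ and $\overline{W}_k$ denote the $k\times k$ leading principal submatrices of $W$ and $\overline{W}$ respectively. Then for every $k=1,\ldots,n$, $$\det(\overline{W}_k)=(-1)^{\frac{k(k-1)}{2}}\det(W_k).$$
   Context: $J$ denotes the all-ones $n\times n$ matrix and $I$ the identity matrix. -}

module Defs where

open import Data.Nat as ℕ using (ℕ; zero; suc; _≤_)
open import Data.Nat.Properties using (≤-trans)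
open import Data.Integer using (ℤ; +_; _+_; _-_; _*_; -_; 0ℤ; 1ℤ)
open import Data.Fin using (Fin; zero; suc; punchIn; inject≤; toℕ)
open import Data.Bool using (Bool; true; false; if_then_else_)
open import Relation.Binary.PropositionalEquality using (_≡_; _≢_)

Matrix : ℕ → Set
Matrix n = Fin n → Fin n → ℤ

Vector : ℕ → Set
Vector n = Fin n → ℤ

record Graph (n : ℕ) : Set where
  field
    adj       : Fin n → Fin n → Bool
    symmetric : ∀ i j → adj i j ≡ adj j i
    loopless  : ∀ i → adj i i ≡ false
open Graph public

∑ : ∀ {n} → (Fin n → ℤ) → ℤ
∑ {zero}  f = 0ℤ
∑ {suc n} f = f zero + ∑ (λ i → f (suc i))

adjMatrix : ∀ {n} → Graph n → Matrix n
adjMatrix G i j = if adj G i j then 1ℤ else 0ℤ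

δ : ∀ {n} → Fin n → Fin n → ℤ
δ zero    zero    = 1ℤ
δ zero    (suc j) = 0ℤ
δ (suc i) zero    = 0ℤ
δ (suc i) (suc j) = δ i j

I : ∀ {n} → Matrix n
I = δ

J : ∀ {n} → Matrix n
J _ _ = 1ℤ

complementMatrix : ∀ {n} → Matrix n → Matrix n
complementMatrix A i j = (J i j - I i j) - A i j

_·_ : ∀ {n} → Matrix n → Vector n → Vector n
(M · v) i = ∑ (λ j → M i j * v j)

e : ∀ {n} → Vector n
e _ = 1ℤ

powApply : ∀ {n} → Matrix n → ℕ → Vector n
powApply A zero    = e
powApply A (suc m) = A · powApply A m

walkMatrix : ∀ {n} → Matrix n → Matrix n
walkMatrix A i j = powApply A (toℕ j) i

leading : ∀ {n} (k : ℕ) → k ≤ n → Matrix n → Matrix k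
leading k k≤n M i j = M (inject≤ i k≤n) (inject≤ j k≤n)

minor : ∀ {n} → Matrix (suc n) → Fin (suc n) → Matrix n
minor M j r c = M (suc r) (punchIn j c)

altSign : ℕ → ℤ
altSign zero          = 1ℤ
altSign (suc zero)    = - 1ℤ
altSign (suc (suc m)) = altSign m

det : ∀ {n} → Matrix n → ℤ
det {zero}  M = 1ℤ
det {suc n} M = ∑ (λ j → altSign (toℕ j) * (M zero j * det (minor M j)))

signPow : ℕ → ℤ
signPow = altSign

-- Since Ā = J − I − A and J v = (Σᵢ vᵢ) e, one has Ā v = (Σᵢ vᵢ) e − v − A v.  By induction on m,
-- Ā^m e − (−1)^m A^m e lies in the span of e, A e, …, A^(m−1) e.  Restricted to the first k rows
-- this says W̄_k = W_k U with U upper triangular and diagonal ((−1)^0, …, (−1)^(k−1)), so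
-- det W̄_k = (−1)^(0 + 1 + ⋯ + (k−1)) det W_k.  Nothing about A
-- being an adjacency matrix is used.

module Submission where

open import Defs

module _ where

  open import Data.Nat as ℕ using (ℕ; zero; suc)
  import Data.Nat.Properties as ℕ
  open import Data.Nat.DivMod using (m*n/n≡m; +-distrib-/-∣ʳ)
  open import Data.Nat.Divisibility using (divides-refl)
  open import Data.Integer using (ℤ; +0; +[1+_]; -[1+_]; _+_; _-_; _*_; -_; _^_; 0ℤ; 1ℤ; -1ℤ)
  open import Data.Integer.Properties
    using ( +-identityˡ; +-identityʳ; +-assoc; *-identityˡ; *-assoc; *-zeroˡ; *-zeroʳ
          ; +-*-semiring; neg-injective; -1*i≡-i; ^-distribˡ-+-* )
  open import Data.Integer.Tactic.RingSolver using (solve-∀)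
  import Data.Fin as Fin
  open import Data.Fin using (Fin; Fin′; zero; suc; toℕ; inject; inject₁; punchIn; punchOut; _≟_)
  open import Data.Fin.Properties
    using ( toℕ-injective; toℕ-inject; toℕ-inject₁; toℕ-inject≤; toℕ-fromℕ; toℕ-fromℕ<; toℕ<n
          ; <⇒≢; ≤∧≢⇒<; <⇒≤pred; punchInᵢ≢i; punchIn-injective; punchIn-punchOut )
  open import Data.Fin.Induction using (<-weakInduction)
  open import Data.List as List using (List; []; _∷_; _++_)
  open import Data.Product using (Σ; _×_; _,_; map₁; map₂)
  open import Data.Empty using (⊥-elim)
  open import Function using (_∘_)
  open import Relation.Nullary using (Dec; yes; no; ¬_)
  open import Relation.Binary.PropositionalEquality
  open import Algebra.Properties.Semiring.Sum +-*-semiring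
    using (sum; sum-cong-≗; ∑-distrib-+; *-distribˡ-sum)
  open ≡-Reasoning

  altSign≡-1^ : ∀ m → altSign m ≡ -1ℤ ^ m
  altSign≡-1^ zero          = refl
  altSign≡-1^ (suc zero)    = refl
  altSign≡-1^ (suc (suc m)) = trans (altSign≡-1^ m) (square (-1ℤ ^ m))
    where
    square : ∀ x → x ≡ -1ℤ * (-1ℤ * x)
    square = solve-∀

  altSign-suc : ∀ m → altSign (suc m) ≡ - altSign m
  altSign-suc m = begin
    altSign (suc m)  ≡⟨ altSign≡-1^ (suc m) ⟩
    -1ℤ * -1ℤ ^ m    ≡⟨ -1*i≡-i (-1ℤ ^ m) ⟩
    - (-1ℤ ^ m)      ≡⟨ cong -_ (altSign≡-1^ m) ⟨
    - altSign m      ∎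

  altSign-+ : ∀ m n → altSign (m ℕ.+ n) ≡ altSign m * altSign n
  altSign-+ m n = begin
    altSign (m ℕ.+ n)      ≡⟨ altSign≡-1^ (m ℕ.+ n) ⟩
    -1ℤ ^ (m ℕ.+ n)        ≡⟨ ^-distribˡ-+-* -1ℤ m n ⟩
    -1ℤ ^ m * -1ℤ ^ n      ≡⟨ cong₂ _*_ (altSign≡-1^ m) (altSign≡-1^ n) ⟨
    altSign m * altSign n  ∎

  ∏< : (ℕ → ℤ) → ℕ → ℤ
  ∏< s zero    = 1ℤ
  ∏< s (suc k) = ∏< s k * s k

  [1+k]*k/2≡k*[k∸1]/2+k : ∀ k → (suc k ℕ.* k) ℕ./ 2 ≡ (k ℕ.* (k ℕ.∸ 1)) ℕ./ 2 ℕ.+ k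
  [1+k]*k/2≡k*[k∸1]/2+k zero    = refl
  [1+k]*k/2≡k*[k∸1]/2+k (suc j) = begin
    (suc (suc j) ℕ.* suc j) ℕ./ 2                ≡⟨ cong (ℕ._/ 2) (split j) ⟩
    (suc j ℕ.* j ℕ.+ suc j ℕ.* 2) ℕ./ 2          ≡⟨ +-distrib-/-∣ʳ (suc j ℕ.* j) {d = 2} (divides-refl (suc j)) ⟩
    (suc j ℕ.* j) ℕ./ 2 ℕ.+ (suc j ℕ.* 2) ℕ./ 2  ≡⟨ cong ((suc j ℕ.* j) ℕ./ 2 ℕ.+_) (m*n/n≡m (suc j) 2) ⟩
    (suc j ℕ.* j) ℕ./ 2 ℕ.+ suc j                ∎
    where
    open import Data.Nat.Tactic.RingSolver renaming (solve-∀ to ℕ-solve-∀)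
    split : ∀ j → suc (suc j) ℕ.* suc j ≡ suc j ℕ.* j ℕ.+ suc j ℕ.* 2
    split = ℕ-solve-∀

  ∏<-altSign : ∀ k → ∏< altSign k ≡ altSign ((k ℕ.* (k ℕ.∸ 1)) ℕ./ 2)
  ∏<-altSign zero    = refl
  ∏<-altSign (suc k) = begin
    ∏< altSign k * altSign k                         ≡⟨ cong (_* altSign k) (∏<-altSign k) ⟩
    altSign ((k ℕ.* (k ℕ.∸ 1)) ℕ./ 2) * altSign k   ≡⟨ altSign-+ ((k ℕ.* (k ℕ.∸ 1)) ℕ./ 2) k ⟨
    altSign ((k ℕ.* (k ℕ.∸ 1)) ℕ./ 2 ℕ.+ k)         ≡⟨ cong altSign ([1+k]*k/2≡k*[k∸1]/2+k k) ⟨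
    altSign ((suc k ℕ.* k) ℕ./ 2)                    ∎

  i≡-i⇒i≡0 : ∀ {i : ℤ} → i ≡ - i → i ≡ 0ℤ
  i≡-i⇒i≡0 {+0}        _  = refl
  i≡-i⇒i≡0 {+[1+ _ ]}  ()
  i≡-i⇒i≡0 { -[1+ _ ]} ()

  ∑≡sum : ∀ {n} (f : Fin n → ℤ) → ∑ f ≡ sum f
  ∑≡sum {zero}  f = refl
  ∑≡sum {suc n} f = cong (f zero +_) (∑≡sum (f ∘ suc))

  ∑-cong : ∀ {n} {f g : Fin n → ℤ} → f ≗ g → ∑ f ≡ ∑ g
  ∑-cong {f = f} {g} f≗g = begin
    ∑ f    ≡⟨ ∑≡sum f ⟩
    sum f  ≡⟨ sum-cong-≗ f≗g ⟩
    sum g  ≡⟨ ∑≡sum g ⟨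
    ∑ g    ∎

  ∑-scale : ∀ {n} (a : ℤ) (f : Fin n → ℤ) → ∑ (λ i → a * f i) ≡ a * ∑ f
  ∑-scale a f = begin
    ∑ (λ i → a * f i)    ≡⟨ ∑≡sum (λ i → a * f i) ⟩
    sum (λ i → a * f i)  ≡⟨ *-distribˡ-sum a f ⟨
    a * sum f            ≡⟨ cong (a *_) (∑≡sum f) ⟨
    a * ∑ f              ∎

  ∑-linear : ∀ {n} (a b : ℤ) (f g : Fin n → ℤ) → ∑ (λ i → a * f i + b * g i) ≡ a * ∑ f + b * ∑ g
  ∑-linear a b f g = begin
    ∑ (λ i → a * f i + b * g i)                 ≡⟨ ∑≡sum (λ i → a * f i + b * g i) ⟩
    sum (λ i → a * f i + b * g i)               ≡⟨ ∑-distrib-+ (λ i → a * f i) (λ i → b * g i) ⟩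
    sum (λ i → a * f i) + sum (λ i → b * g i)  ≡⟨ cong₂ _+_ (∑≡sum (λ i → a * f i)) (∑≡sum (λ i → b * g i)) ⟨
    ∑ (λ i → a * f i) + ∑ (λ i → b * g i)      ≡⟨ cong₂ _+_ (∑-scale a f) (∑-scale b g) ⟩
    a * ∑ f + b * ∑ g                           ∎

  ∑-δ : ∀ {n} (r : Fin n) (v : Vector n) → ∑ (λ j → δ r j * v j) ≡ v r
  ∑-δ zero    v = trans (cong (1ℤ * v zero +_) (trans (∑-cong (λ j → sym (*-zeroˡ (v (suc j))))) (∑-scale 0ℤ (v ∘ suc))))
                        (unit (v zero) (∑ (v ∘ suc)))
    where
    unit : ∀ x y → 1ℤ * x + 0ℤ * y ≡ x
    unit = solve-∀
  ∑-δ (suc r) v = trans (cong (0ℤ * v zero +_) (∑-δ r (v ∘ suc))) (unit (v zero) (v (suc r)))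
    where
    unit : ∀ x y → 0ℤ * x + y ≡ y
    unit = solve-∀

  -- Transpositions of adjacent positions

  data Adjacent : ∀ {n} → Fin n → Fin n → Set where
    here  : ∀ {n} → Adjacent {suc (suc n)} zero (suc zero)
    there : ∀ {n} {a b : Fin n} → Adjacent a b → Adjacent (suc a) (suc b)

  swap : ∀ {n} {a b : Fin n} → Adjacent a b → Fin n → Fin n
  swap here      zero          = suc zero
  swap here      (suc zero)    = zero
  swap here      (suc (suc k)) = suc (suc k)
  swap (there h) zero          = zero
  swap (there h) (suc k)       = suc (swap h k)

  swap-left : ∀ {n} {a b : Fin n} (h : Adjacent a b) → swap h a ≡ b
  swap-left here      = refl
  swap-left (there h) = cong suc (swap-left h)

  swap-right : ∀ {n} {a b : Fin n} (h : Adjacent a b) → swap h b ≡ a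
  swap-right here      = refl
  swap-right (there h) = cong suc (swap-right h)

  swap-fixed : ∀ {n} {a b : Fin n} (h : Adjacent a b) {c} → c ≢ a → c ≢ b → swap h c ≡ c
  swap-fixed here      {zero}        c≢a c≢b = ⊥-elim (c≢a refl)
  swap-fixed here      {suc zero}    c≢a c≢b = ⊥-elim (c≢b refl)
  swap-fixed here      {suc (suc c)} c≢a c≢b = refl
  swap-fixed (there h) {zero}        c≢a c≢b = refl
  swap-fixed (there h) {suc c}       c≢a c≢b = cong suc (swap-fixed h (c≢a ∘ cong suc) (c≢b ∘ cong suc))

  ∑-swap : ∀ {n} {a b : Fin n} (h : Adjacent a b) (f : Fin n → ℤ) → ∑ f ≡ ∑ (f ∘ swap h)
  ∑-swap here      f = exchange (f zero) (f (suc zero)) (∑ (λ c → f (suc (suc c))))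
    where
    exchange : ∀ x y z → x + (y + z) ≡ y + (x + z)
    exchange = solve-∀
  ∑-swap (there h) f = cong (f zero +_) (∑-swap h (f ∘ suc))

  adjacent-toℕ : ∀ {n} {a b : Fin n} → Adjacent a b → toℕ b ≡ suc (toℕ a)
  adjacent-toℕ here      = refl
  adjacent-toℕ (there h) = cong suc (adjacent-toℕ h)

  altSign-adjacent : ∀ {n} {a b : Fin n} → Adjacent a b → altSign (toℕ b) ≡ - altSign (toℕ a)
  altSign-adjacent {a = a} h = trans (cong altSign (adjacent-toℕ h)) (altSign-suc (toℕ a))

  adjacent-inject₁ : ∀ {n} (j : Fin n) → Adjacent (inject₁ j) (suc j)
  adjacent-inject₁ {suc n} zero    = here
  adjacent-inject₁         (suc j) = there (adjacent-inject₁ j)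

  adjacent-punchOut : ∀ {n} {a b : Fin (suc n)} → Adjacent a b →
                      ∀ {c} (c≢a : c ≢ a) (c≢b : c ≢ b) → Adjacent (punchOut c≢a) (punchOut c≢b)
  adjacent-punchOut here {zero}      c≢a c≢b = ⊥-elim (c≢a refl)
  adjacent-punchOut here {suc zero}  c≢a c≢b = ⊥-elim (c≢b refl)
  adjacent-punchOut {suc (suc n)} here {suc (suc c)} c≢a c≢b = here
  adjacent-punchOut (there h) {zero} c≢a c≢b = h
  adjacent-punchOut {suc n} (there h) {suc c} c≢a c≢b = there (adjacent-punchOut h (c≢a ∘ cong suc) (c≢b ∘ cong suc))

  swap-punchIn-left : ∀ {n} {a b : Fin (suc n)} (h : Adjacent a b) x → swap h (punchIn a x) ≡ punchIn b x
  swap-punchIn-left here      zero    = refl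
  swap-punchIn-left here      (suc x) = refl
  swap-punchIn-left (there h) zero    = refl
  swap-punchIn-left (there h) (suc x) = cong suc (swap-punchIn-left h x)

  swap-punchIn-right : ∀ {n} {a b : Fin (suc n)} (h : Adjacent a b) x → swap h (punchIn b x) ≡ punchIn a x
  swap-punchIn-right here      zero    = refl
  swap-punchIn-right here      (suc x) = refl
  swap-punchIn-right (there h) zero    = refl
  swap-punchIn-right (there h) (suc x) = cong suc (swap-punchIn-right h x)

  swap-punchIn : ∀ {n} {a b : Fin (suc n)} (h : Adjacent a b) {c} (c≢a : c ≢ a) (c≢b : c ≢ b) x →
                 swap h (punchIn c x) ≡ punchIn c (swap (adjacent-punchOut h c≢a c≢b) x)
  swap-punchIn here {zero}     c≢a c≢b x = ⊥-elim (c≢a refl)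
  swap-punchIn here {suc zero} c≢a c≢b x = ⊥-elim (c≢b refl)
  swap-punchIn {suc (suc n)} here {suc (suc c)} c≢a c≢b zero          = refl
  swap-punchIn {suc (suc n)} here {suc (suc c)} c≢a c≢b (suc zero)    = refl
  swap-punchIn {suc (suc n)} here {suc (suc c)} c≢a c≢b (suc (suc x)) = refl
  swap-punchIn (there h) {zero} c≢a c≢b x = refl
  swap-punchIn {suc n} (there h) {suc c} c≢a c≢b zero    = refl
  swap-punchIn {suc n} (there h) {suc c} c≢a c≢b (suc x) = cong suc (swap-punchIn h (c≢a ∘ cong suc) (c≢b ∘ cong suc) x)

  -- Linear combinations of vectors

  linComb : ∀ {I : Set} {n} → (I → Vector n) → List (I × ℤ) → Vector n
  linComb u []             r = 0ℤ
  linComb u ((i , c) ∷ xs) r = c * u i r + linComb u xs r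

  Span : ∀ {I : Set} {n} → (I → Vector n) → Vector n → Set
  Span {I} u v = Σ (List (I × ℤ)) λ xs → v ≗ linComb u xs

  linComb-cong : ∀ {I : Set} {n} {u v : I → Vector n} → (∀ i → u i ≗ v i) → ∀ xs → linComb u xs ≗ linComb v xs
  linComb-cong u≗v []             r = refl
  linComb-cong u≗v ((i , c) ∷ xs) r = cong₂ (λ x y → c * x + y) (u≗v i r) (linComb-cong u≗v xs r)

  linComb-restrict : ∀ {I : Set} {m n} (u : I → Vector m) (g : Fin n → Fin m) xs r →
                     linComb u xs (g r) ≡ linComb (λ i → u i ∘ g) xs r
  linComb-restrict u g []             r = refl
  linComb-restrict u g ((i , c) ∷ xs) r = cong (c * u i (g r) +_) (linComb-restrict u g xs r)

  linComb-reindex : ∀ {I J : Set} {n} (g : I → J) (u : J → Vector n) xs →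
                    linComb u (List.map (map₁ g) xs) ≗ linComb (u ∘ g) xs
  linComb-reindex g u []             r = refl
  linComb-reindex g u ((i , c) ∷ xs) r = cong (c * u (g i) r +_) (linComb-reindex g u xs r)

  module _ {I : Set} {n} {u : I → Vector n} where

    linComb-++ : ∀ xs ys r → linComb u (xs ++ ys) r ≡ linComb u xs r + linComb u ys r
    linComb-++ []             ys r = sym (+-identityˡ _)
    linComb-++ ((i , c) ∷ xs) ys r = trans (cong (c * u i r +_) (linComb-++ xs ys r)) (sym (+-assoc (c * u i r) _ _))

    linComb-scale : ∀ a xs r → linComb u (List.map (map₂ (a *_)) xs) r ≡ a * linComb u xs r
    linComb-scale a []             r = sym (*-zeroʳ a)
    linComb-scale a ((i , c) ∷ xs) r =
      trans (cong ((a * c) * u i r +_) (linComb-scale a xs r)) (distribute a c (u i r) (linComb u xs r))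
      where
      distribute : ∀ a c x y → (a * c) * x + a * y ≡ a * (c * x + y)
      distribute = solve-∀

    span-resp : ∀ {v w} → v ≗ w → Span u v → Span u w
    span-resp v≗w (xs , v≗xs) = xs , λ r → trans (sym (v≗w r)) (v≗xs r)

    span-basis : ∀ i a → Span u (λ r → a * u i r)
    span-basis i a = (i , a) ∷ [] , λ r → sym (+-identityʳ _)

    span-+ : ∀ {v w} → Span u v → Span u w → Span u (λ r → v r + w r)
    span-+ (xs , v≗xs) (ys , w≗ys) = xs ++ ys , λ r → trans (cong₂ _+_ (v≗xs r) (w≗ys r)) (sym (linComb-++ xs ys r))

    span-scale : ∀ a {v} → Span u v → Span u (λ r → a * v r)
    span-scale a (xs , v≗xs) = List.map (map₂ (a *_)) xs , λ r → trans (cong (a *_) (v≗xs r)) (sym (linComb-scale a xs r))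

  span-reindex : ∀ {I J : Set} {n} {u : I → Vector n} {u′ : J → Vector n} (g : I → J) →
                 (∀ i → u′ (g i) ≗ u i) → ∀ {v} → Span u v → Span u′ v
  span-reindex {u′ = u′} g u′∘g≗u (xs , v≗xs) = List.map (map₁ g) xs , λ r →
    trans (v≗xs r) (trans (linComb-cong (λ i r → sym (u′∘g≗u i r)) xs r) (sym (linComb-reindex g u′ xs r)))

  ·-cong : ∀ {n} (M : Matrix n) {v w : Vector n} → v ≗ w → M · v ≗ M · w
  ·-cong M v≗w r = ∑-cong (λ j → cong (M r j *_) (v≗w j))

  ·-linear : ∀ {n} (M : Matrix n) (a b : ℤ) (v w : Vector n) r →
             (M · (λ j → a * v j + b * w j)) r ≡ a * (M · v) r + b * (M · w) r
  ·-linear M a b v w r =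
    trans (∑-cong (λ j → distribute (M r j) a b (v j) (w j))) (∑-linear a b (λ j → M r j * v j) (λ j → M r j * w j))
    where
    distribute : ∀ m a b x y → m * (a * x + b * y) ≡ a * (m * x) + b * (m * y)
    distribute = solve-∀

  ·-linComb : ∀ {I : Set} {n} (M : Matrix n) (u : I → Vector n) xs → M · linComb u xs ≗ linComb (λ i → M · u i) xs
  ·-linComb M u [] r =
    trans (∑-cong (λ j → trans (*-zeroʳ (M r j)) (sym (*-zeroˡ (M r j))))) (trans (∑-scale 0ℤ (M r)) (*-zeroˡ (∑ (M r))))
  ·-linComb M u ((i , c) ∷ xs) r = begin
    (M · (λ j → c * u i j + linComb u xs j)) r       ≡⟨ ·-cong M (λ j → cong (c * u i j +_) (sym (*-identityˡ _))) r ⟩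
    (M · (λ j → c * u i j + 1ℤ * linComb u xs j)) r  ≡⟨ ·-linear M c 1ℤ (u i) (linComb u xs) r ⟩
    c * (M · u i) r + 1ℤ * (M · linComb u xs) r      ≡⟨ cong (c * (M · u i) r +_) (*-identityˡ _) ⟩
    c * (M · u i) r + (M · linComb u xs) r           ≡⟨ cong (c * (M · u i) r +_) (·-linComb M u xs r) ⟩
    c * (M · u i) r + linComb (λ i → M · u i) xs r   ∎

  span-· : ∀ {I : Set} {n} (M : Matrix n) {u : I → Vector n} {v} → Span u v → Span (λ i → M · u i) (M · v)
  span-· M {u} (xs , v≗xs) = xs , λ r → trans (·-cong M v≗xs r) (·-linComb M u xs r)

  -- Determinants

  AgreeOffColumn : ∀ {n} → Fin n → Matrix n → Matrix n → Set
  AgreeOffColumn j M N = ∀ r c → c ≢ j → M r c ≡ N r c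

  cofactor : ∀ {n} → Matrix (suc n) → Fin (suc n) → ℤ
  cofactor M j = altSign (toℕ j) * (M zero j * det (minor M j))

  det-cong : ∀ {n} {M N : Matrix n} → (∀ r c → M r c ≡ N r c) → det M ≡ det N
  det-cong {zero}  _   = refl
  det-cong {suc n} M≡N = ∑-cong λ j →
    cong₂ (λ x d → altSign (toℕ j) * (x * d)) (M≡N zero j) (det-cong λ r c → M≡N (suc r) (punchIn j c))

  agreeOff⇒minor≡ : ∀ {n} {M N : Matrix (suc n)} {j} → AgreeOffColumn j M N → ∀ r x → minor M j r x ≡ minor N j r x
  agreeOff⇒minor≡ {j = j} M≈N r x = M≈N (suc r) (punchIn j x) (punchInᵢ≢i j x)

  agreeOff⇒minor-agreeOff : ∀ {n} {M N : Matrix (suc n)} {c j} (c≢j : c ≢ j) → AgreeOffColumn j M N →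
                            AgreeOffColumn (punchOut c≢j) (minor M c) (minor N c)
  agreeOff⇒minor-agreeOff {c = c} c≢j M≈N r x x≢j′ = M≈N (suc r) (punchIn c x) λ eq →
    x≢j′ (punchIn-injective c x _ (trans eq (sym (punchIn-punchOut c≢j))))

  minor-punchOut : ∀ {n} (M : Matrix (suc n)) {c j} (c≢j : c ≢ j) r → minor M c r (punchOut c≢j) ≡ M (suc r) j
  minor-punchOut M c≢j r = cong (M (suc r)) (punchIn-punchOut c≢j)

  det-linear : ∀ {n} {M N P : Matrix n} (j : Fin n) (a b : ℤ) →
               (∀ r → M r j ≡ a * N r j + b * P r j) → AgreeOffColumn j M N → AgreeOffColumn j M P →
               det M ≡ a * det N + b * det P
  det-linear {zero} () a b Mj M≈N M≈P
  det-linear {suc n} {M} {N} {P} j a b Mj M≈N M≈P = trans (∑-cong expand) (∑-linear a b (cofactor N) (cofactor P))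
    where
    expand : ∀ c → cofactor M c ≡ a * cofactor N c + b * cofactor P c
    expand c with c ≟ j
    ... | yes refl = begin
      s * (M zero c * d)                                   ≡⟨ cong (λ x → s * (x * d)) (Mj zero) ⟩
      s * ((a * N zero c + b * P zero c) * d)              ≡⟨ distribute s a b (N zero c) (P zero c) d ⟩
      a * (s * (N zero c * d)) + b * (s * (P zero c * d))
        ≡⟨ cong₂ (λ dN dP → a * (s * (N zero c * dN)) + b * (s * (P zero c * dP)))
                 (det-cong (agreeOff⇒minor≡ M≈N)) (det-cong (agreeOff⇒minor≡ M≈P)) ⟩
      a * cofactor N c + b * cofactor P c                  ∎
      where
      s = altSign (toℕ c)
      d = det (minor M c)
      distribute : ∀ s a b x y d → s * ((a * x + b * y) * d) ≡ a * (s * (x * d)) + b * (s * (y * d))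
      distribute = solve-∀
    ... | no c≢j = begin
      s * (x * det (minor M c))                              ≡⟨ cong (λ d → s * (x * d)) minor-linear ⟩
      s * (x * (a * det (minor N c) + b * det (minor P c)))  ≡⟨ distribute s x a b _ _ ⟩
      a * (s * (x * det (minor N c))) + b * (s * (x * det (minor P c)))
        ≡⟨ cong₂ (λ y z → a * (s * (y * det (minor N c))) + b * (s * (z * det (minor P c))))
                 (M≈N zero c c≢j) (M≈P zero c c≢j) ⟩
      a * cofactor N c + b * cofactor P c                    ∎
      where
      s = altSign (toℕ c)
      x = M zero c
      distribute : ∀ s x a b dN dP → s * (x * (a * dN + b * dP)) ≡ a * (s * (x * dN)) + b * (s * (x * dP))
      distribute = solve-∀
      minor-linear : det (minor M c) ≡ a * det (minor N c) + b * det (minor P c)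
      minor-linear = det-linear (punchOut c≢j) a b
        (λ r → trans (minor-punchOut M c≢j r) (trans (Mj (suc r))
                 (sym (cong₂ (λ x y → a * x + b * y) (minor-punchOut N c≢j r) (minor-punchOut P c≢j r)))))
        (agreeOff⇒minor-agreeOff c≢j M≈N) (agreeOff⇒minor-agreeOff c≢j M≈P)

  module _ {n} {M N : Matrix (suc n)} {a b : Fin (suc n)} (h : Adjacent a b)
           (N≡M∘swap : ∀ r c → N r c ≡ M r (swap h c)) where

    cofactor-swap-left : cofactor N a ≡ -1ℤ * cofactor M b
    cofactor-swap-left = begin
      altSign (toℕ a) * (N zero a * det (minor N a))
        ≡⟨ cong₂ (λ x d → altSign (toℕ a) * (x * d)) (trans (N≡M∘swap zero a) (cong (M zero) (swap-left h)))
                 (det-cong λ r x → trans (N≡M∘swap (suc r) _) (cong (M (suc r)) (swap-punchIn-left h x))) ⟩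
      altSign (toℕ a) * (M zero b * det (minor M b))
        ≡⟨ negate (altSign (toℕ a)) (M zero b) (det (minor M b)) ⟩
      -1ℤ * (- altSign (toℕ a) * (M zero b * det (minor M b)))
        ≡⟨ cong (λ s → -1ℤ * (s * (M zero b * det (minor M b)))) (altSign-adjacent h) ⟨
      -1ℤ * cofactor M b ∎
      where
      negate : ∀ s x d → s * (x * d) ≡ -1ℤ * (- s * (x * d))
      negate = solve-∀

    cofactor-swap-right : cofactor N b ≡ -1ℤ * cofactor M a
    cofactor-swap-right = begin
      altSign (toℕ b) * (N zero b * det (minor N b))
        ≡⟨ cong₂ (λ x d → altSign (toℕ b) * (x * d)) (trans (N≡M∘swap zero b) (cong (M zero) (swap-right h)))
                 (det-cong λ r x → trans (N≡M∘swap (suc r) _) (cong (M (suc r)) (swap-punchIn-right h x))) ⟩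
      altSign (toℕ b) * (M zero a * det (minor M a))
        ≡⟨ cong (λ s → s * (M zero a * det (minor M a))) (altSign-adjacent h) ⟩
      - altSign (toℕ a) * (M zero a * det (minor M a))
        ≡⟨ negate (altSign (toℕ a)) (M zero a) (det (minor M a)) ⟩
      -1ℤ * cofactor M a ∎
      where
      negate : ∀ s x d → - s * (x * d) ≡ -1ℤ * (s * (x * d))
      negate = solve-∀

  -- Expanding along the first row, the cofactors of N at a and b are those of M at b and a with
  -- the opposite sign; every other cofactor of N is minus that of M, by induction on the minors.
  det-swap : ∀ {n} {M N : Matrix n} {a b : Fin n} (h : Adjacent a b) →
             (∀ r c → N r c ≡ M r (swap h c)) → det N ≡ - det M
  det-swap {suc n} {M} {N} {a} {b} h N≡M∘swap = begin
    ∑ (cofactor N)                          ≡⟨ ∑-cong negated ⟩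
    ∑ (λ c → -1ℤ * cofactor M (swap h c))   ≡⟨ ∑-scale -1ℤ (cofactor M ∘ swap h) ⟩
    -1ℤ * ∑ (cofactor M ∘ swap h)           ≡⟨ cong (-1ℤ *_) (∑-swap h (cofactor M)) ⟨
    -1ℤ * det M                             ≡⟨ -1*i≡-i (det M) ⟩
    - det M                                 ∎
    where
    negated : ∀ c → cofactor N c ≡ -1ℤ * cofactor M (swap h c)
    negated c with c ≟ a | c ≟ b
    ... | yes refl | _        rewrite swap-left h  = cofactor-swap-left {M = M} {N = N} h N≡M∘swap
    ... | no _     | yes refl rewrite swap-right h = cofactor-swap-right {M = M} {N = N} h N≡M∘swap
    ... | no c≢a   | no c≢b   rewrite swap-fixed h c≢a c≢b = begin
      altSign (toℕ c) * (N zero c * det (minor N c))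
        ≡⟨ cong₂ (λ x d → altSign (toℕ c) * (x * d)) (trans (N≡M∘swap zero c) (cong (M zero) (swap-fixed h c≢a c≢b)))
                 minor-swapped ⟩
      altSign (toℕ c) * (M zero c * - det (minor M c))
        ≡⟨ negate (altSign (toℕ c)) (M zero c) (det (minor M c)) ⟩
      -1ℤ * cofactor M c ∎
      where
      negate : ∀ s x d → s * (x * - d) ≡ -1ℤ * (s * (x * d))
      negate = solve-∀
      minor-swapped : det (minor N c) ≡ - det (minor M c)
      minor-swapped = det-swap (adjacent-punchOut h c≢a c≢b) λ r x →
        trans (N≡M∘swap (suc r) _) (cong (M (suc r)) (swap-punchIn h c≢a c≢b x))

  det-adjacent-equal : ∀ {n} {M : Matrix n} {a b : Fin n} → Adjacent a b → (∀ r → M r a ≡ M r b) → det M ≡ 0ℤ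
  det-adjacent-equal {M = M} {a} {b} h Ma≡Mb = i≡-i⇒i≡0 (det-swap h swap-invariant)
    where
    swap-invariant : ∀ r c → M r c ≡ M r (swap h c)
    swap-invariant r c with c ≟ a | c ≟ b
    ... | yes refl | _        = trans (Ma≡Mb r) (cong (M r) (sym (swap-left h)))
    ... | no _     | yes refl = trans (sym (Ma≡Mb r)) (cong (M r) (sym (swap-right h)))
    ... | no c≢a   | no c≢b   = cong (M r) (sym (swap-fixed h c≢a c≢b))

  -- Swapping column j with its left neighbour moves the copy of column i one step closer.
  det-equal-columns : ∀ {n} {M : Matrix n} {i j : Fin n} → i Fin.< j → (∀ r → M r i ≡ M r j) → det M ≡ 0ℤ
  det-equal-columns {suc n} {j = j} = <-weakInduction EqualToColumn (λ ()) step j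
    where
    EqualToColumn : Fin (suc n) → Set
    EqualToColumn j = ∀ {M : Matrix (suc n)} {i} → i Fin.< j → (∀ r → M r i ≡ M r j) → det M ≡ 0ℤ
    step : ∀ j → EqualToColumn (inject₁ j) → EqualToColumn (suc j)
    step j ih {M} {i} i<j+1 Mi≡Mj+1 with i ≟ inject₁ j
    ... | yes refl = det-adjacent-equal {M = M} (adjacent-inject₁ j) Mi≡Mj+1
    ... | no i≢j   = neg-injective (begin
      - det M  ≡⟨ det-swap {M = M} {N = N} h (λ r c → refl) ⟨
      det N    ≡⟨ ih {M = N} (≤∧≢⇒< (<⇒≤pred i<j+1) i≢j)
                     (λ r → trans (cong (M r) (swap-fixed h i≢j (<⇒≢ i<j+1)))
                                  (trans (Mi≡Mj+1 r) (cong (M r) (sym (swap-left h))))) ⟩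
      0ℤ       ∎)
      where
      h = adjacent-inject₁ j
      N : Matrix (suc n)
      N r c = M r (swap h c)

  setColumn : ∀ {n} → Matrix n → Fin n → Vector n → Matrix n
  setColumn M j v r c with c ≟ j
  ... | yes _ = v r
  ... | no _  = M r c

  setColumn-≡ : ∀ {n} (M : Matrix n) j v r → setColumn M j v r j ≡ v r
  setColumn-≡ M j v r with j ≟ j
  ... | yes _  = refl
  ... | no j≢j = ⊥-elim (j≢j refl)

  setColumn-agreeOff : ∀ {n} (M : Matrix n) j v → AgreeOffColumn j (setColumn M j v) M
  setColumn-agreeOff M j v r c c≢j with c ≟ j
  ... | yes c≡j = ⊥-elim (c≢j c≡j)
  ... | no _    = refl

  det-add-earlier-columns : ∀ {n} {I : Set} {M N : Matrix n} {j : Fin n} (s : ℤ) (f : I → Fin n) xs →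
    (∀ i → f i Fin.< j) → AgreeOffColumn j M N →
    (∀ r → M r j ≡ s * N r j + linComb (λ i r → N r (f i)) xs r) → det M ≡ s * det N
  det-add-earlier-columns {M = M} {N} {j} s f [] _ M≈N Mj = begin
    det M                   ≡⟨ det-linear j s 0ℤ (λ r → trans (Mj r) (pad (s * N r j) (N r j))) M≈N M≈N ⟩
    s * det N + 0ℤ * det N  ≡⟨ absorb (s * det N) (det N) ⟩
    s * det N               ∎
    where
    pad : ∀ x y → x + 0ℤ ≡ x + 0ℤ * y
    pad = solve-∀
    absorb : ∀ x y → x + 0ℤ * y ≡ x
    absorb = solve-∀
  det-add-earlier-columns {M = M} {N} {j} s f ((i , c) ∷ xs) f<j M≈N Mj = begin
    det M                      ≡⟨ det-linear j c 1ℤ Mj′ M≈Q M≈R ⟩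
    c * det Q + 1ℤ * det R     ≡⟨ cong₂ (λ x y → c * x + 1ℤ * y) det-Q≡0 det-R ⟩
    c * 0ℤ + 1ℤ * (s * det N)  ≡⟨ simplify c (s * det N) ⟩
    s * det N                  ∎
    where
    rest : Vector _
    rest r = s * N r j + linComb (λ i r → N r (f i)) xs r
    Q R : Matrix _
    Q = setColumn N j (λ r → N r (f i))
    R = setColumn N j rest
    regroup : ∀ a b x y → a + (b * x + y) ≡ b * x + 1ℤ * (a + y)
    regroup = solve-∀
    simplify : ∀ c x → c * 0ℤ + 1ℤ * x ≡ x
    simplify = solve-∀
    Mj′ : ∀ r → M r j ≡ c * Q r j + 1ℤ * R r j
    Mj′ r = trans (Mj r) (trans (regroup (s * N r j) c (N r (f i)) (linComb (λ i r → N r (f i)) xs r))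
                  (sym (cong₂ (λ x y → c * x + 1ℤ * y) (setColumn-≡ N j _ r) (setColumn-≡ N j rest r))))
    M≈Q : AgreeOffColumn j M Q
    M≈Q r c c≢j = trans (M≈N r c c≢j) (sym (setColumn-agreeOff N j _ r c c≢j))
    M≈R : AgreeOffColumn j M R
    M≈R r c c≢j = trans (M≈N r c c≢j) (sym (setColumn-agreeOff N j rest r c c≢j))
    det-Q≡0 : det Q ≡ 0ℤ
    det-Q≡0 = det-equal-columns (f<j i) λ r →
      trans (setColumn-agreeOff N j _ r (f i) (<⇒≢ (f<j i))) (sym (setColumn-≡ N j _ r))
    det-R : det R ≡ s * det N
    det-R = det-add-earlier-columns s f xs f<j (setColumn-agreeOff N j rest) (setColumn-≡ N j rest)

  -- Upper triangular changes of columns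

  inject-< : ∀ {n} {c : Fin n} (i : Fin′ c) → inject i Fin.< c
  inject-< {c = c} i = subst (ℕ._< toℕ c) (sym (toℕ-inject i)) (toℕ<n i)

  -- M′ = M U with U upper triangular and diagonal (s 0, s 1, …, s (k − 1)).
  TriangularColumnChange : ∀ {k} → (ℕ → ℤ) → Matrix k → Matrix k → Set
  TriangularColumnChange {k} s M M′ = ∀ (c : Fin k) → Σ (List (Fin′ c × ℤ)) λ xs →
    ∀ r → M′ r c ≡ s (toℕ c) * M r c + linComb (λ i r → M r (inject i)) xs r

  module _ {k} (s : ℕ → ℤ) {M M′ : Matrix k} (M⇝M′ : TriangularColumnChange s M M′) where

    private
      mixColumns : ℕ → Matrix k
      mixColumns t r c with toℕ c ℕ.<? t
      ... | yes _ = M r c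
      ... | no _  = M′ r c

      mixColumns-< : ∀ {t} r c → toℕ c ℕ.< t → mixColumns t r c ≡ M r c
      mixColumns-< {t} r c c<t with toℕ c ℕ.<? t
      ... | yes _  = refl
      ... | no c≮t = ⊥-elim (c≮t c<t)

      mixColumns-≮ : ∀ {t} r c → ¬ toℕ c ℕ.< t → mixColumns t r c ≡ M′ r c
      mixColumns-≮ {t} r c c≮t with toℕ c ℕ.<? t
      ... | yes c<t = ⊥-elim (c≮t c<t)
      ... | no _    = refl

      det-mixColumns-step : ∀ c → det (mixColumns (toℕ c)) ≡ s (toℕ c) * det (mixColumns (suc (toℕ c)))
      det-mixColumns-step c with M⇝M′ c
      ... | xs , M′c = det-add-earlier-columns (s (toℕ c)) inject xs inject-< agree column
        where
        agree : AgreeOffColumn c (mixColumns (toℕ c)) (mixColumns (suc (toℕ c)))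
        agree r c′ c′≢c = by-cases (toℕ c′ ℕ.<? toℕ c)
          where
          by-cases : Dec (toℕ c′ ℕ.< toℕ c) → mixColumns (toℕ c) r c′ ≡ mixColumns (suc (toℕ c)) r c′
          by-cases (yes c′<c) = trans (mixColumns-< r c′ c′<c) (sym (mixColumns-< r c′ (ℕ.m<n⇒m<1+n c′<c)))
          by-cases (no c′≮c)  = trans (mixColumns-≮ r c′ c′≮c) (sym (mixColumns-≮ r c′ c′≮c+1))
            where
            c′≮c+1 : ¬ toℕ c′ ℕ.< suc (toℕ c)
            c′≮c+1 c′<c+1 = c′≢c (toℕ-injective (ℕ.≤-antisym (ℕ.s≤s⁻¹ c′<c+1) (ℕ.≮⇒≥ c′≮c)))
        column : ∀ r → mixColumns (toℕ c) r c
                         ≡ s (toℕ c) * mixColumns (suc (toℕ c)) r c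
                           + linComb (λ i r → mixColumns (suc (toℕ c)) r (inject i)) xs r
        column r = begin
          mixColumns (toℕ c) r c                                     ≡⟨ mixColumns-≮ r c (ℕ.<-irrefl refl) ⟩
          M′ r c                                                     ≡⟨ M′c r ⟩
          s (toℕ c) * M r c + linComb (λ i r → M r (inject i)) xs r
            ≡⟨ cong₂ (λ x y → s (toℕ c) * x + y) (sym (mixColumns-< r c (ℕ.n<1+n (toℕ c))))
                     (linComb-cong (λ i r → sym (mixColumns-< r (inject i) (ℕ.m<n⇒m<1+n (inject-< i)))) xs r) ⟩
          s (toℕ c) * mixColumns (suc (toℕ c)) r c + linComb (λ i r → mixColumns (suc (toℕ c)) r (inject i)) xs r ∎

      det-mixColumns : ∀ {t} → t ℕ.≤ k → det (mixColumns 0) ≡ ∏< s t * det (mixColumns t)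
      det-mixColumns {zero}  _   = sym (*-identityˡ _)
      det-mixColumns {suc t} t<k = begin
        det (mixColumns 0)                         ≡⟨ det-mixColumns (ℕ.<⇒≤ t<k) ⟩
        ∏< s t * det (mixColumns t)                ≡⟨ cong (∏< s t *_) step ⟩
        ∏< s t * (s t * det (mixColumns (suc t)))  ≡⟨ *-assoc (∏< s t) (s t) _ ⟨
        ∏< s t * s t * det (mixColumns (suc t))    ∎
        where
        step : det (mixColumns t) ≡ s t * det (mixColumns (suc t))
        step = subst (λ t → det (mixColumns t) ≡ s t * det (mixColumns (suc t)))
                     (toℕ-fromℕ< t<k) (det-mixColumns-step (Fin.fromℕ< t<k))

    det-triangularColumnChange : det M′ ≡ ∏< s k * det M
    det-triangularColumnChange = begin
      det M′                        ≡⟨ det-cong (λ r c → sym (mixColumns-≮ {0} r c (λ ()))) ⟩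
      det (mixColumns 0)            ≡⟨ det-mixColumns ℕ.≤-refl ⟩
      ∏< s k * det (mixColumns k)   ≡⟨ cong (∏< s k *_) (det-cong (λ r c → mixColumns-< r c (toℕ<n c))) ⟩
      ∏< s k * det M                ∎

  -- Walk matrices

  complement-· : ∀ {n} (A : Matrix n) (v : Vector n) r → (complementMatrix A · v) r ≡ (∑ v - v r) - (A · v) r
  complement-· A v r = begin
    ∑ (λ j → ((1ℤ - δ r j) - A r j) * v j)
      ≡⟨ ∑-cong (λ j → split (δ r j) (A r j) (v j)) ⟩
    ∑ (λ j → 1ℤ * v j + -1ℤ * (δ r j * v j + A r j * v j))
      ≡⟨ ∑-linear 1ℤ -1ℤ v (λ j → δ r j * v j + A r j * v j) ⟩
    1ℤ * ∑ v + -1ℤ * ∑ (λ j → δ r j * v j + A r j * v j)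
      ≡⟨ cong (λ x → 1ℤ * ∑ v + -1ℤ * x) (trans (∑-cong (λ j → ones (δ r j * v j) (A r j * v j)))
                                                  (∑-linear 1ℤ 1ℤ (λ j → δ r j * v j) (λ j → A r j * v j))) ⟩
    1ℤ * ∑ v + -1ℤ * (1ℤ * ∑ (λ j → δ r j * v j) + 1ℤ * (A · v) r)
      ≡⟨ cong (λ x → 1ℤ * ∑ v + -1ℤ * (1ℤ * x + 1ℤ * (A · v) r)) (∑-δ r v) ⟩
    1ℤ * ∑ v + -1ℤ * (1ℤ * v r + 1ℤ * (A · v) r)
      ≡⟨ collect (∑ v) (v r) ((A · v) r) ⟩
    (∑ v - v r) - (A · v) r ∎
    where
    split : ∀ d a x → ((1ℤ - d) - a) * x ≡ 1ℤ * x + -1ℤ * (d * x + a * x)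
    split = solve-∀
    ones : ∀ x y → x + y ≡ 1ℤ * x + 1ℤ * y
    ones = solve-∀
    collect : ∀ s x y → 1ℤ * s + -1ℤ * (1ℤ * x + 1ℤ * y) ≡ (s - x) - y
    collect = solve-∀

  walkColumns : ∀ {n} → Matrix n → (m : ℕ) → Fin m → Vector n
  walkColumns A m i = powApply A (toℕ i)

  complement-walk : ∀ {n} (A : Matrix n) m →
    Span (walkColumns A m) (λ r → powApply (complementMatrix A) m r - altSign m * powApply A m r)
  complement-walk A zero    = [] , λ r → refl
  complement-walk A (suc m) = span-resp recurrence
    (span-+ (span-+ (span-+ (span-basis zero σ) (span-basis (Fin.fromℕ m) (- s)))
                    (span-scale -1ℤ (span-reindex inject₁ earlier (complement-walk A m))))
            (span-scale -1ℤ (span-reindex suc (λ i r → refl) (span-· A (complement-walk A m)))))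
    where
    Ā = complementMatrix A
    P = powApply A
    s = altSign m
    σ = ∑ (powApply Ā m)
    d : Vector _
    d r = powApply Ā m r - s * P m r
    earlier : ∀ i → walkColumns A (suc m) (inject₁ i) ≗ walkColumns A m i
    earlier i r = cong (λ t → P t r) (toℕ-inject₁ i)
    split : powApply Ā m ≗ λ r → s * P m r + 1ℤ * d r
    split r = rearrange (powApply Ā m r) s (P m r)
      where
      rearrange : ∀ x s p → x ≡ s * p + 1ℤ * (x - s * p)
      rearrange = solve-∀
    recurrence : ∀ r → ((σ * 1ℤ + - s * P (toℕ (Fin.fromℕ m)) r) + -1ℤ * d r) + -1ℤ * (A · d) r
                     ≡ powApply Ā (suc m) r - altSign (suc m) * P (suc m) r
    recurrence r = begin
      ((σ * 1ℤ + - s * P (toℕ (Fin.fromℕ m)) r) + -1ℤ * d r) + -1ℤ * (A · d) r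
        ≡⟨ cong (λ t → ((σ * 1ℤ + - s * P t r) + -1ℤ * d r) + -1ℤ * (A · d) r) (toℕ-fromℕ m) ⟩
      ((σ * 1ℤ + - s * P m r) + -1ℤ * d r) + -1ℤ * (A · d) r
        ≡⟨ expand σ s (P m r) (P (suc m) r) (d r) ((A · d) r) ⟩
      ((σ - (s * P m r + 1ℤ * d r)) - (s * P (suc m) r + 1ℤ * (A · d) r)) - (- s) * P (suc m) r
        ≡⟨ cong₂ (λ x y → ((σ - x) - y) - (- s) * P (suc m) r) (split r)
                 (trans (·-cong A split r) (·-linear A s 1ℤ (P m) d r)) ⟨
      ((σ - powApply Ā m r) - (A · powApply Ā m) r) - (- s) * P (suc m) r
        ≡⟨ cong₂ _-_ (complement-· A (powApply Ā m) r) (cong (_* P (suc m) r) (altSign-suc m)) ⟨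
      powApply Ā (suc m) r - altSign (suc m) * P (suc m) r ∎
      where
      expand : ∀ σ s p p′ x y → ((σ * 1ℤ + - s * p) + -1ℤ * x) + -1ℤ * y
                              ≡ ((σ - (s * p + 1ℤ * x)) - (s * p′ + 1ℤ * y)) - (- s) * p′
      expand = solve-∀

  leading-walkMatrix : ∀ {n} (B : Matrix n) {k} (k≤n : k ℕ.≤ n) r c →
                       leading k k≤n (walkMatrix B) r c ≡ powApply B (toℕ c) (Fin.inject≤ r k≤n)
  leading-walkMatrix B k≤n r c = cong (λ t → powApply B t (Fin.inject≤ r k≤n)) (toℕ-inject≤ c k≤n)

  leading-walkMatrix-complement : ∀ {n} (A : Matrix n) {k} (k≤n : k ℕ.≤ n) →
    TriangularColumnChange altSign (leading k k≤n (walkMatrix A)) (leading k k≤n (walkMatrix (complementMatrix A)))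
  leading-walkMatrix-complement A {k} k≤n c with complement-walk A (toℕ c)
  ... | xs , difference = xs , λ r → begin
    W̄ r c                                                 ≡⟨ leading-walkMatrix Ā k≤n r c ⟩
    powApply Ā m (row r)                                   ≡⟨ rearrange (powApply Ā m (row r)) s (powApply A m (row r)) ⟩
    s * powApply A m (row r) + (powApply Ā m (row r) - s * powApply A m (row r))
      ≡⟨ cong₂ (λ x y → s * x + y) (sym (leading-walkMatrix A k≤n r c)) (difference (row r)) ⟩
    s * W r c + linComb (walkColumns A m) xs (row r)       ≡⟨ cong (s * W r c +_) (linComb-restrict (walkColumns A m) row xs r) ⟩
    s * W r c + linComb (λ i → walkColumns A m i ∘ row) xs r
      ≡⟨ cong (s * W r c +_) (linComb-cong (λ i r → trans (cong (λ t → powApply A t (row r)) (sym (toℕ-inject i)))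
                                                           (sym (leading-walkMatrix A k≤n r (inject i)))) xs r) ⟩
    s * W r c + linComb (λ i r → W r (inject i)) xs r      ∎
    where
    Ā = complementMatrix A
    W = leading k k≤n (walkMatrix A)
    W̄ = leading k k≤n (walkMatrix Ā)
    m = toℕ c
    s = altSign m
    row : Fin k → Fin _
    row r = Fin.inject≤ r k≤n
    rearrange : ∀ x s p → x ≡ s * p + (x - s * p)
    rearrange = solve-∀

  det-leading-walkMatrix-complement : ∀ {n} (A : Matrix n) k (k≤n : k ℕ.≤ n) →
    det (leading k k≤n (walkMatrix (complementMatrix A)))
      ≡ altSign ((k ℕ.* (k ℕ.∸ 1)) ℕ./ 2) * det (leading k k≤n (walkMatrix A))
  det-leading-walkMatrix-complement A k k≤n = begin
    det (leading k k≤n (walkMatrix (complementMatrix A)))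
      ≡⟨ det-triangularColumnChange altSign (leading-walkMatrix-complement A k≤n) ⟩
    ∏< altSign k * det (leading k k≤n (walkMatrix A))
      ≡⟨ cong (_* det (leading k k≤n (walkMatrix A))) (∏<-altSign k) ⟩
    altSign ((k ℕ.* (k ℕ.∸ 1)) ℕ./ 2) * det (leading k k≤n (walkMatrix A)) ∎

open import Data.Nat using (ℕ; _≤_; _*_; _∸_; _/_)
open import Data.Integer using () renaming (_*_ to _*ℤ_)
open import Relation.Binary.PropositionalEquality using (_≡_)

corollary2p2 : ∀ {n} (G : Graph n) (k : ℕ) → 1 ≤ k → (k≤n : k ≤ n) →
    det (leading k k≤n (walkMatrix (complementMatrix (adjMatrix G))))
      ≡ signPow ((k * (k ∸ 1)) / 2) *ℤ det (leading k k≤n (walkMatrix (adjMatrix G)))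
corollary2p2 G k _ k≤n = det-leading-walkMatrix-complement (adjMatrix G) k k≤n
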